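{- For every type $\tau$ and all closed terms $t,s$ of type $\tau$: if $\mathcal{L}^{\omega}_{\tau}(t,s)$ then $t\lesssim_\tau s$, where $t\lesssim_\tau s$ means that for every type $\tau'$ and every context $C$ of type $\tau'$ with a hole of type $\tau$, if $C[t]{\Downarrow}$ then $C[s]{\Downarrow}$.
   Context: Types of $\mu$TCL: closed type expressions, modulo $\alpha$-equivalence, of the grammar $\tau::=\alpha\mid \tau_1\boxplus\tau_2\mid\tau_1\boxtimes\tau_2\mid \tau_1\Rightarrow\tau_2\mid \mu\alpha.\tau$. Closed terms are built from: constants $S_{\tau_1,\tau_2,\tau_3}\colon(\tau_1\Rightarrow\tau_2\Rightarrow\tau_3)\Rightarrow(\tau_1\Rightarrow\tau_2)\Rightarrow\tau_1\Rightarrow\tau_3$, $K_{\tau_1,\tau_2}\colon \tau_1\Rightarrow\tau_2\Rightarrow\tau_1$, $I_\tau\colon\tau\Rightarrow\tau$; operations $S'\colon(\tau_1\Rightarrow\tau_2\Rightarrow\tau_3)\to((\tau_1\Rightarrow\tau_2)\Rightarrow\tau_1\Rightarrow\tau_3)$, $S''\colon (\tau_1\Rightarrow\tau_2\Rightarrow\tau_3)\times(\tau_1\Rightarrow\tau_2)\to(\tau_1\Rightarrow\tau_3)$, $K'\colon\tau_1\to(\tau_2\Rightarrow\tau_1)$, application $t\,s$ of type $\tau_2$ for $t\colon\tau_1\Rightarrow\tau_2$, $s\colon\tau_1$, $\mathsf{inl}\colon\tau_1\to\tau_1\boxplus\tau_2$, $\mathsf{inr}\colon\tau_2\to\tau_1\boxplus\tau_2$,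 $\mathsf{case}\colon(\tau_1\boxplus\tau_2)\times(\tau_1\Rightarrow\tau_3)\times(\tau_2\Rightarrow\tau_3)\to\tau_3$, $\mathsf{pair}\colon\tau_1\times\tau_2\to\tau_1\boxtimes\tau_2$, $\mathsf{fst}\colon\tau_1\boxtimes\tau_2\to\tau_1$, $\mathsf{snd}\colon\tau_1\boxtimes\tau_2\to\tau_2$, $\mathsf{fold}_\tau\colon\tau[\mu\alpha.\tau/\alpha]\to\mu\alpha.\tau$, $\mathsf{unfold}_\tau\colon\mu\alpha.\tau\to\tau[\mu\alpha.\tau/\alpha]$. A context $C$ of type $\tau'$ with hole of type $\tau$ is a term of type $\tau'$ over this signature with at most one occurrence of a variable $\cdot$ of type $\tau$; $C[t]$ substitutes $t$ for it. Transitions are exactly those derivable by: $S\xrightarrow{e}S'(e)$; $S'(t)\xrightarrow{e}S''(t,e)$; $S''(t,s)\xrightarrow{e}(t\,e)(s\,e)$; $K\xrightarrow{e}K'(e)$; $K'(t)\xrightarrow{e}t$; $I\xrightarrow{e}e$; $t\to t'\Rightarrow t\,s\to t'\,s$; $t\xrightarrow{s}t'\Rightarrow t\,s\to t'$; $\mathsf{inl}(t)\xrightarrow{\boxplus_1}t$; $\mathsf{inr}(t)\xrightarrow{\boxplus_2}t$; $t\to t'\Rightarrow\mathsf{case}(t,s,r)\to\mathsf{case}(t',s,r)$; $t\xrightarrow{\boxplus_1}t'\Rightarrow\mathsf{case}(t,s,r)\to s\,t'$; $t\xrightarrow{\boxplus_2}t'\Rightarrow\mathsf{case}(t,s,r)\to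 r\,t'$; $\mathsf{pair}(t,s)\xrightarrow{\boxtimes_1}t$; $\mathsf{pair}(t,s)\xrightarrow{\boxtimes_2}s$; $t\to t'\Rightarrow\mathsf{fst}(t)\to\mathsf{fst}(t'),\ \mathsf{snd}(t)\to\mathsf{snd}(t')$; $t\xrightarrow{\boxtimes_1}t'\Rightarrow\mathsf{fst}(t)\to t'$; $t\xrightarrow{\boxtimes_2}t'\Rightarrow\mathsf{snd}(t)\to t'$; $\mathsf{fold}(t)\xrightarrow{\mu}t$; $t\to t'\Rightarrow\mathsf{unfold}(t)\to\mathsf{unfold}(t')$; $t\xrightarrow{\mu}t'\Rightarrow\mathsf{unfold}(t)\to t'$. $\Rightarrow$ is the reflexive transitive closure of $\to$; $t\overset{l}{\Rightarrow}s$ iff $t\Rightarrow t'\xrightarrow{l}s$ for some $t'$; $t{\Downarrow}$ iff $t\overset{l}{\Rightarrow}s$ for some label $l$ (a term or one of $\boxplus_1,\boxplus_2,\boxtimes_1,\boxtimes_2,\mu$) and some $s$. For type-indexed relations $Q,R$: $\mathcal{E}(R)_\tau=\{(t,s)\mid t\to t'\implies\exists s'.\,s\Rightarrow s'\wedge R_\tau(t',s')\}$; $\mathcal{V}_{\tau_1\boxplus\tau_2}(Q,R)=\{(t,s)\mid$ for $i=1,2$: $t\xrightarrow{\boxplus_i}t'\implies\exists s'.\,s\overset{\boxplus_i}{\Rightarrow}s'\wedge R_{\tau_i}(t',s')\}$; $\mathcal{V}_{\tau_1\boxtimes\tau_2}(Q,R)=\{(t,s)\mid t\xrightarrow{\boxtimes_1}t_1\wedge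 t\xrightarrow{\boxtimes_2}t_2\implies \exists s_1,s_2.\,s\overset{\boxtimes_1}{\Rightarrow}s_1\wedge s\overset{\boxtimes_2}{\Rightarrow}s_2\wedge R_{\tau_1}(t_1,s_1)\wedge R_{\tau_2}(t_2,s_2)\}$; $\mathcal{V}_{\tau_1\Rightarrow\tau_2}(Q,R)=\{(t,s)\mid\forall e_1,e_2.\,Q_{\tau_1}(e_1,e_2)\wedge t\xrightarrow{e_1}t'\implies\exists s'.\,s\overset{e_2}{\Rightarrow}s'\wedge R_{\tau_2}(t',s')\}$; $\mathcal{V}_{\mu\alpha.\tau}(Q,R)=\{(t,s)\mid t\xrightarrow{\mu}t'\implies\exists s'.\,s\overset{\mu}{\Rightarrow}s'\wedge R_{\tau[\mu\alpha.\tau/\alpha]}(t',s')\}$. $\mathcal{L}^0$ is the full relation, $\mathcal{L}^{n+1}=\mathcal{L}^n\cap\mathcal{E}(\mathcal{L}^n)\cap\mathcal{V}(\mathcal{L}^n,\mathcal{L}^n)$, $\mathcal{L}^\omega=\bigcap_{n<\omega}\mathcal{L}^n$. -}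

module Defs where

open import Data.Nat using (ℕ; zero; suc; _+_; _≤_)
open import Data.Fin using (Fin; zero; suc)
open import Data.Maybe using (Maybe; just; nothing)
open import Data.Unit using (⊤; tt)
open import Data.Product using (Σ; ∃; _×_; _,_)
open import Relation.Binary.Construct.Closure.ReflexiveTransitive using (Star)

-- Types of μTCL.  Type expressions with n free type variables, in
-- de Bruijn representation (so α-equivalent expressions are equal).
-- Types of μTCL are the closed ones: Ty 0.

infixr 7 _⇒_
infixr 8 _⊞_
infixr 9 _⊠_

data Ty (n : ℕ) : Set where
  var  : Fin n → Ty n
  _⊞_  : Ty n → Ty n → Ty n
  _⊠_  : Ty n → Ty n → Ty n
  _⇒_  : Ty n → Ty n → Ty n
  μ    : Ty (suc n) → Ty n

extʳ : ∀ {m n} → (Fin m → Fin n) → Fin (suc m) → Fin (suc n)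
extʳ ρ zero    = zero
extʳ ρ (suc i) = suc (ρ i)

ren : ∀ {m n} → (Fin m → Fin n) → Ty m → Ty n
ren ρ (var i)   = var (ρ i)
ren ρ (a ⊞ b)   = ren ρ a ⊞ ren ρ b
ren ρ (a ⊠ b)   = ren ρ a ⊠ ren ρ b
ren ρ (a ⇒ b)   = ren ρ a ⇒ ren ρ b
ren ρ (μ a)     = μ (ren (extʳ ρ) a)

extˢ : ∀ {m n} → (Fin m → Ty n) → Fin (suc m) → Ty (suc n)
extˢ σ zero    = var zero
extˢ σ (suc i) = ren suc (σ i)

sub : ∀ {m n} → (Fin m → Ty n) → Ty m → Ty n
sub σ (var i) = σ i
sub σ (a ⊞ b) = sub σ a ⊞ sub σ b
sub σ (a ⊠ b) = sub σ a ⊠ sub σ b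
sub σ (a ⇒ b) = sub σ a ⇒ sub σ b
sub σ (μ a)   = μ (sub (extˢ σ) a)

sub₀ : ∀ {n} → Ty n → Fin (suc n) → Ty n
sub₀ u zero    = u
sub₀ u (suc i) = var i

-- τ [ u /α]  (α = the outermost bound variable, de Bruijn index 0)
_[_]₀ : ∀ {n} → Ty (suc n) → Ty n → Ty n
τ [ u ]₀ = sub (sub₀ u) τ

Type : Set
Type = Ty 0

-- Exp nothing τ   : closed terms of type τ
-- Exp (just σ) τ  : terms of type τ over the signature extended with a
--                   variable · of type σ (any number of occurrences;
--                   contexts additionally require at most one).

data Exp : Maybe Type → Type → Set where
  ·     : ∀ {σ} → Exp (just σ) σ
  S     : ∀ {Γ τ₁ τ₂ τ₃} → Exp Γ ((τ₁ ⇒ τ₂ ⇒ τ₃) ⇒ (τ₁ ⇒ τ₂) ⇒ τ₁ ⇒ τ₃)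
  K     : ∀ {Γ τ₁ τ₂} → Exp Γ (τ₁ ⇒ τ₂ ⇒ τ₁)
  I     : ∀ {Γ τ} → Exp Γ (τ ⇒ τ)
  S′    : ∀ {Γ τ₁ τ₂ τ₃} → Exp Γ (τ₁ ⇒ τ₂ ⇒ τ₃) → Exp Γ ((τ₁ ⇒ τ₂) ⇒ τ₁ ⇒ τ₃)
  S″    : ∀ {Γ τ₁ τ₂ τ₃} → Exp Γ (τ₁ ⇒ τ₂ ⇒ τ₃) → Exp Γ (τ₁ ⇒ τ₂) → Exp Γ (τ₁ ⇒ τ₃)
  K′    : ∀ {Γ τ₁ τ₂} → Exp Γ τ₁ → Exp Γ (τ₂ ⇒ τ₁)
  app   : ∀ {Γ τ₁ τ₂} → Exp Γ (τ₁ ⇒ τ₂) → Exp Γ τ₁ → Exp Γ τ₂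
  inl   : ∀ {Γ τ₁ τ₂} → Exp Γ τ₁ → Exp Γ (τ₁ ⊞ τ₂)
  inr   : ∀ {Γ τ₁ τ₂} → Exp Γ τ₂ → Exp Γ (τ₁ ⊞ τ₂)
  case  : ∀ {Γ τ₁ τ₂ τ₃} → Exp Γ (τ₁ ⊞ τ₂) → Exp Γ (τ₁ ⇒ τ₃) → Exp Γ (τ₂ ⇒ τ₃) → Exp Γ τ₃
  pair  : ∀ {Γ τ₁ τ₂} → Exp Γ τ₁ → Exp Γ τ₂ → Exp Γ (τ₁ ⊠ τ₂)
  fst   : ∀ {Γ τ₁ τ₂} → Exp Γ (τ₁ ⊠ τ₂) → Exp Γ τ₁
  snd   : ∀ {Γ τ₁ τ₂} → Exp Γ (τ₁ ⊠ τ₂) → Exp Γ τ₂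
  fold  : ∀ {Γ} (τ : Ty 1) → Exp Γ (τ [ μ τ ]₀) → Exp Γ (μ τ)
  unfold : ∀ {Γ} (τ : Ty 1) → Exp Γ (μ τ) → Exp Γ (τ [ μ τ ]₀)

Tm : Type → Set
Tm = Exp nothing

occ : ∀ {Γ τ} → Exp Γ τ → ℕ
occ ·            = 1
occ S            = 0
occ K            = 0
occ I            = 0
occ (S′ t)       = occ t
occ (S″ t s)     = occ t + occ s
occ (K′ t)       = occ t
occ (app t s)    = occ t + occ s
occ (inl t)      = occ t
occ (inr t)      = occ t
occ (case t s r) = occ t + occ s + occ r
occ (pair t s)   = occ t + occ s
occ (fst t)      = occ t
occ (snd t)      = occ t
occ (fold τ t)   = occ t
occ (unfold τ t) = occ t

_[_] : ∀ {σ τ} → Exp (just σ) τ → Tm σ → Tm τ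
·            [ u ] = u
S            [ u ] = S
K            [ u ] = K
I            [ u ] = I
S′ t         [ u ] = S′ (t [ u ])
S″ t s       [ u ] = S″ (t [ u ]) (s [ u ])
K′ t         [ u ] = K′ (t [ u ])
app t s      [ u ] = app (t [ u ]) (s [ u ])
inl t        [ u ] = inl (t [ u ])
inr t        [ u ] = inr (t [ u ])
case t s r   [ u ] = case (t [ u ]) (s [ u ]) (r [ u ])
pair t s     [ u ] = pair (t [ u ]) (s [ u ])
fst t        [ u ] = fst (t [ u ])
snd t        [ u ] = snd (t [ u ])
fold τ t     [ u ] = fold τ (t [ u ])
unfold τ t   [ u ] = unfold τ (t [ u ])

data Lab : Type → Type → Set where
  arg : ∀ {τ₁ τ₂} → Tm τ₁ → Lab (τ₁ ⇒ τ₂) τ₂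
  ⊞₁  : ∀ {τ₁ τ₂} → Lab (τ₁ ⊞ τ₂) τ₁
  ⊞₂  : ∀ {τ₁ τ₂} → Lab (τ₁ ⊞ τ₂) τ₂
  ⊠₁  : ∀ {τ₁ τ₂} → Lab (τ₁ ⊠ τ₂) τ₁
  ⊠₂  : ∀ {τ₁ τ₂} → Lab (τ₁ ⊠ τ₂) τ₂
  μl  : ∀ {τ : Ty 1} → Lab (μ τ) (τ [ μ τ ]₀)

data _—[_]→_ : ∀ {τ σ} → Tm τ → Lab τ σ → Tm σ → Set where
  S-lab   : ∀ {τ₁ τ₂ τ₃} {e : Tm (τ₁ ⇒ τ₂ ⇒ τ₃)} → S —[ arg e ]→ S′ e
  S′-lab  : ∀ {τ₁ τ₂ τ₃} {t : Tm (τ₁ ⇒ τ₂ ⇒ τ₃)} {e : Tm (τ₁ ⇒ τ₂)} → S′ t —[ arg e ]→ S″ t e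
  S″-lab  : ∀ {τ₁ τ₂ τ₃} {t : Tm (τ₁ ⇒ τ₂ ⇒ τ₃)} {s : Tm (τ₁ ⇒ τ₂)} {e : Tm τ₁} →
            S″ t s —[ arg e ]→ app (app t e) (app s e)
  K-lab   : ∀ {τ₁ τ₂} {e : Tm τ₁} → K {τ₂ = τ₂} —[ arg e ]→ K′ e
  K′-lab  : ∀ {τ₁ τ₂} {t : Tm τ₁} {e : Tm τ₂} → K′ t —[ arg e ]→ t
  I-lab   : ∀ {τ} {e : Tm τ} → I —[ arg e ]→ e
  inl-lab : ∀ {τ₁ τ₂} {t : Tm τ₁} → inl {τ₂ = τ₂} t —[ ⊞₁ ]→ t
  inr-lab : ∀ {τ₁ τ₂} {t : Tm τ₂} → inr {τ₁ = τ₁} t —[ ⊞₂ ]→ t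
  pair₁   : ∀ {τ₁ τ₂} {t : Tm τ₁} {s : Tm τ₂} → pair t s —[ ⊠₁ ]→ t
  pair₂   : ∀ {τ₁ τ₂} {t : Tm τ₁} {s : Tm τ₂} → pair t s —[ ⊠₂ ]→ s
  fold-lab : ∀ {τ} {t : Tm (τ [ μ τ ]₀)} → fold τ t —[ μl ]→ t

data _⟶_ : ∀ {τ} → Tm τ → Tm τ → Set where
  app-ξ   : ∀ {τ₁ τ₂} {t t′ : Tm (τ₁ ⇒ τ₂)} {s : Tm τ₁} → t ⟶ t′ → app t s ⟶ app t′ s
  app-β   : ∀ {τ₁ τ₂} {t : Tm (τ₁ ⇒ τ₂)} {s : Tm τ₁} {t′ : Tm τ₂} → t —[ arg s ]→ t′ → app t s ⟶ t′
  case-ξ  : ∀ {τ₁ τ₂ τ₃} {t t′ : Tm (τ₁ ⊞ τ₂)} {s : Tm (τ₁ ⇒ τ₃)} {r : Tm (τ₂ ⇒ τ₃)} →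
            t ⟶ t′ → case t s r ⟶ case t′ s r
  case-β₁ : ∀ {τ₁ τ₂ τ₃} {t : Tm (τ₁ ⊞ τ₂)} {t′ : Tm τ₁} {s : Tm (τ₁ ⇒ τ₃)} {r : Tm (τ₂ ⇒ τ₃)} →
            t —[ ⊞₁ ]→ t′ → case t s r ⟶ app s t′
  case-β₂ : ∀ {τ₁ τ₂ τ₃} {t : Tm (τ₁ ⊞ τ₂)} {t′ : Tm τ₂} {s : Tm (τ₁ ⇒ τ₃)} {r : Tm (τ₂ ⇒ τ₃)} →
            t —[ ⊞₂ ]→ t′ → case t s r ⟶ app r t′
  fst-ξ   : ∀ {τ₁ τ₂} {t t′ : Tm (τ₁ ⊠ τ₂)} → t ⟶ t′ → fst t ⟶ fst t′
  snd-ξ   : ∀ {τ₁ τ₂} {t t′ : Tm (τ₁ ⊠ τ₂)} → t ⟶ t′ → snd t ⟶ snd t′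
  fst-β   : ∀ {τ₁ τ₂} {t : Tm (τ₁ ⊠ τ₂)} {t′ : Tm τ₁} → t —[ ⊠₁ ]→ t′ → fst t ⟶ t′
  snd-β   : ∀ {τ₁ τ₂} {t : Tm (τ₁ ⊠ τ₂)} {t′ : Tm τ₂} → t —[ ⊠₂ ]→ t′ → snd t ⟶ t′
  unfold-ξ : ∀ {τ} {t t′ : Tm (μ τ)} → t ⟶ t′ → unfold τ t ⟶ unfold τ t′
  unfold-β : ∀ {τ} {t : Tm (μ τ)} {t′ : Tm (τ [ μ τ ]₀)} → t —[ μl ]→ t′ → unfold τ t ⟶ t′

_⟹_ : ∀ {τ} → Tm τ → Tm τ → Set
_⟹_ = Star _⟶_

_=[_]⇒_ : ∀ {τ σ} → Tm τ → Lab τ σ → Tm σ → Set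
_=[_]⇒_ {τ} t l s = Σ (Tm τ) λ t′ → (t ⟹ t′) × (t′ —[ l ]→ s)

_⇓ : ∀ {τ} → Tm τ → Set
_⇓ {τ} t = Σ Type λ σ → Σ (Lab τ σ) λ l → Σ (Tm σ) λ s → t =[ l ]⇒ s

TRel : Set₁
TRel = (τ : Type) → Tm τ → Tm τ → Set

𝓔 : TRel → TRel
𝓔 R τ t s = ∀ t′ → t ⟶ t′ → Σ (Tm τ) λ s′ → (s ⟹ s′) × R τ t′ s′

𝓥 : TRel → TRel → TRel
𝓥 Q R (var ())
𝓥 Q R (τ₁ ⊞ τ₂) t s =
  (∀ t′ → t —[ ⊞₁ ]→ t′ → Σ (Tm τ₁) λ s′ → (s =[ ⊞₁ ]⇒ s′) × R τ₁ t′ s′) ×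
  (∀ t′ → t —[ ⊞₂ ]→ t′ → Σ (Tm τ₂) λ s′ → (s =[ ⊞₂ ]⇒ s′) × R τ₂ t′ s′)
𝓥 Q R (τ₁ ⊠ τ₂) t s =
  ∀ t₁ t₂ → t —[ ⊠₁ ]→ t₁ → t —[ ⊠₂ ]→ t₂ →
  Σ (Tm τ₁) λ s₁ → Σ (Tm τ₂) λ s₂ →
    (s =[ ⊠₁ ]⇒ s₁) × (s =[ ⊠₂ ]⇒ s₂) × R τ₁ t₁ s₁ × R τ₂ t₂ s₂
𝓥 Q R (τ₁ ⇒ τ₂) t s =
  ∀ (e₁ e₂ : Tm τ₁) → Q τ₁ e₁ e₂ → ∀ t′ → t —[ arg e₁ ]→ t′ →
  Σ (Tm τ₂) λ s′ → (s =[ arg e₂ ]⇒ s′) × R τ₂ t′ s′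
𝓥 Q R (μ τ) t s =
  ∀ t′ → t —[ μl ]→ t′ → Σ (Tm (τ [ μ τ ]₀)) λ s′ → (s =[ μl ]⇒ s′) × R (τ [ μ τ ]₀) t′ s′

𝓛 : ℕ → TRel
𝓛 zero    τ t s = ⊤
𝓛 (suc n) τ t s = 𝓛 n τ t s × 𝓔 (𝓛 n) τ t s × 𝓥 (𝓛 n) (𝓛 n) τ t s

𝓛ω : TRel
𝓛ω τ t s = ∀ n → 𝓛 n τ t s

_≲_ : ∀ {τ} → Tm τ → Tm τ → Set
_≲_ {τ} t s =
  ∀ (τ′ : Type) (C : Exp (just τ) τ′) → occ C ≤ 1 → (C [ t ]) ⇓ → (C [ s ]) ⇓

-- Every level 𝓛ⁿ of the step-indexed relation is a congruence for all term
-- formers (by induction on n, using only that 𝓛ⁿ⁺¹ ⊆ 𝓛ⁿ), so 𝓛ω t s gives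
-- 𝓛ⁿ (C[t]) (C[s]) for all n.  If C[t] makes k silent steps and then a labelled
-- transition, k uses of the 𝓔 clause let C[s] follow up to a term still related
-- at level 1, and the 𝓥 clause at level 1 yields a weak labelled transition of
-- C[s].  Taking n = k + 1 gives C[s]⇓.
module Submission where

open import Defs
open import Data.Nat using (ℕ; zero; suc; _+_)
open import Data.Maybe using (just)
open import Data.Unit using (tt)
open import Data.Empty using (⊥-elim)
open import Data.Product using (Σ; _×_; _,_; proj₁; proj₂)
open import Relation.Nullary using (¬_)
open import Relation.Binary.Construct.Closure.ReflexiveTransitive using (ε; _◅_; _◅◅_; gmap)

𝓛-pred : ∀ n {τ t s} → 𝓛 (suc n) τ t s → 𝓛 n τ t s
𝓛-pred n = proj₁

𝓛⇒𝓔 : ∀ {n τ t s} → 𝓛 (suc n) τ t s → 𝓔 (𝓛 n) τ t s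
𝓛⇒𝓔 h = proj₁ (proj₂ h)

𝓛⇒𝓥 : ∀ {n τ t s} → 𝓛 (suc n) τ t s → 𝓥 (𝓛 n) (𝓛 n) τ t s
𝓛⇒𝓥 h = proj₂ (proj₂ h)

𝓥-vacuous : ∀ (Q R : TRel) τ {t s : Tm τ} →
            (∀ {σ} {l : Lab τ σ} {u} → ¬ t —[ l ]→ u) → 𝓥 Q R τ t s
𝓥-vacuous Q R (var ())
𝓥-vacuous Q R (τ₁ ⊞ τ₂) inert = (λ _ p → ⊥-elim (inert p)) , (λ _ p → ⊥-elim (inert p))
𝓥-vacuous Q R (τ₁ ⊠ τ₂) inert = λ _ _ p _ → ⊥-elim (inert p)
𝓥-vacuous Q R (τ₁ ⇒ τ₂) inert = λ _ _ _ _ p → ⊥-elim (inert p)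
𝓥-vacuous Q R (μ τ)     inert = λ _ p → ⊥-elim (inert p)

𝓛-app : ∀ n {τ₁ τ₂} {t s : Tm (τ₁ ⇒ τ₂)} {t₂ s₂ : Tm τ₁} →
        𝓛 n _ t s → 𝓛 n _ t₂ s₂ → 𝓛 n τ₂ (app t t₂) (app s s₂)
𝓛-app zero    _ _ = tt
𝓛-app (suc n) {τ₂ = τ₂} {t} {s} {t₂} {s₂} h h₂ =
  𝓛-app n (𝓛-pred n h) (𝓛-pred n h₂) , simulate , 𝓥-vacuous _ _ τ₂ (λ ())
  where
  simulate : 𝓔 (𝓛 n) τ₂ (app t t₂) (app s s₂)
  simulate _ (app-ξ p) with 𝓛⇒𝓔 h _ p
  ... | s′ , s⟹s′ , h′ = app s′ s₂ , gmap (λ x → app x s₂) app-ξ s⟹s′ , 𝓛-app n h′ (𝓛-pred n h₂)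
  simulate _ (app-β p) with 𝓛⇒𝓥 h t₂ s₂ (𝓛-pred n h₂) _ p
  ... | s′ , (_ , s⟹ , q) , h′ = s′ , gmap (λ x → app x s₂) app-ξ s⟹ ◅◅ app-β q ◅ ε , h′

𝓛-S″ : ∀ n {τ₁ τ₂ τ₃} {t s : Tm (τ₁ ⇒ τ₂ ⇒ τ₃)} {t₂ s₂ : Tm (τ₁ ⇒ τ₂)} →
       𝓛 n _ t s → 𝓛 n _ t₂ s₂ → 𝓛 n (τ₁ ⇒ τ₃) (S″ t t₂) (S″ s s₂)
𝓛-S″ zero    _ _ = tt
𝓛-S″ (suc n) {s = s} {s₂ = s₂} h h₂ = 𝓛-S″ n (𝓛-pred n h) (𝓛-pred n h₂) , (λ _ ()) ,
  λ { _ e₂ q _ S″-lab → app (app s e₂) (app s₂ e₂) , (_ , ε , S″-lab) ,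
                        𝓛-app n (𝓛-app n (𝓛-pred n h) q) (𝓛-app n (𝓛-pred n h₂) q) }

𝓛-S′ : ∀ n {τ₁ τ₂ τ₃} {t s : Tm (τ₁ ⇒ τ₂ ⇒ τ₃)} →
       𝓛 n _ t s → 𝓛 n ((τ₁ ⇒ τ₂) ⇒ τ₁ ⇒ τ₃) (S′ t) (S′ s)
𝓛-S′ zero    _ = tt
𝓛-S′ (suc n) {s = s} h = 𝓛-S′ n (𝓛-pred n h) , (λ _ ()) ,
  λ { _ e₂ q _ S′-lab → S″ s e₂ , (_ , ε , S′-lab) , 𝓛-S″ n (𝓛-pred n h) q }

𝓛-S : ∀ n {τ₁ τ₂ τ₃} → 𝓛 n ((τ₁ ⇒ τ₂ ⇒ τ₃) ⇒ (τ₁ ⇒ τ₂) ⇒ τ₁ ⇒ τ₃) S S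
𝓛-S zero    = tt
𝓛-S (suc n) = 𝓛-S n , (λ _ ()) , λ { _ e₂ q _ S-lab → S′ e₂ , (_ , ε , S-lab) , 𝓛-S′ n q }

𝓛-K′ : ∀ n {τ₁ τ₂} {t s : Tm τ₁} → 𝓛 n _ t s → 𝓛 n (τ₂ ⇒ τ₁) (K′ t) (K′ s)
𝓛-K′ zero    _ = tt
𝓛-K′ (suc n) {s = s} h = 𝓛-K′ n (𝓛-pred n h) , (λ _ ()) ,
  λ { _ _ _ _ K′-lab → s , (_ , ε , K′-lab) , 𝓛-pred n h }

𝓛-K : ∀ n {τ₁ τ₂} → 𝓛 n (τ₁ ⇒ τ₂ ⇒ τ₁) K K
𝓛-K zero    = tt
𝓛-K (suc n) = 𝓛-K n , (λ _ ()) , λ { _ e₂ q _ K-lab → K′ e₂ , (_ , ε , K-lab) , 𝓛-K′ n q }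

𝓛-I : ∀ n {τ} → 𝓛 n (τ ⇒ τ) I I
𝓛-I zero    = tt
𝓛-I (suc n) = 𝓛-I n , (λ _ ()) , λ { _ e₂ q _ I-lab → e₂ , (_ , ε , I-lab) , q }

𝓛-inl : ∀ n {τ₁ τ₂} {t s : Tm τ₁} → 𝓛 n _ t s → 𝓛 n (τ₁ ⊞ τ₂) (inl t) (inl s)
𝓛-inl zero    _ = tt
𝓛-inl (suc n) {s = s} h = 𝓛-inl n (𝓛-pred n h) , (λ _ ()) ,
  (λ { _ inl-lab → s , (_ , ε , inl-lab) , 𝓛-pred n h }) , (λ _ ())

𝓛-inr : ∀ n {τ₁ τ₂} {t s : Tm τ₂} → 𝓛 n _ t s → 𝓛 n (τ₁ ⊞ τ₂) (inr t) (inr s)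
𝓛-inr zero    _ = tt
𝓛-inr (suc n) {s = s} h = 𝓛-inr n (𝓛-pred n h) , (λ _ ()) ,
  (λ _ ()) , (λ { _ inr-lab → s , (_ , ε , inr-lab) , 𝓛-pred n h })

𝓛-case : ∀ n {τ₁ τ₂ τ₃} {t s : Tm (τ₁ ⊞ τ₂)} {t₁ s₁ : Tm (τ₁ ⇒ τ₃)} {t₂ s₂ : Tm (τ₂ ⇒ τ₃)} →
         𝓛 n _ t s → 𝓛 n _ t₁ s₁ → 𝓛 n _ t₂ s₂ → 𝓛 n τ₃ (case t t₁ t₂) (case s s₁ s₂)
𝓛-case zero    _ _ _ = tt
𝓛-case (suc n) {τ₃ = τ₃} {t} {s} {t₁} {s₁} {t₂} {s₂} h h₁ h₂ =
  𝓛-case n (𝓛-pred n h) (𝓛-pred n h₁) (𝓛-pred n h₂) , simulate , 𝓥-vacuous _ _ τ₃ (λ ())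
  where
  simulate : 𝓔 (𝓛 n) τ₃ (case t t₁ t₂) (case s s₁ s₂)
  simulate _ (case-ξ p) with 𝓛⇒𝓔 h _ p
  ... | s′ , s⟹s′ , h′ = case s′ s₁ s₂ , gmap (λ x → case x s₁ s₂) case-ξ s⟹s′ ,
                          𝓛-case n h′ (𝓛-pred n h₁) (𝓛-pred n h₂)
  simulate _ (case-β₁ p) with proj₁ (𝓛⇒𝓥 h) _ p
  ... | s′ , (_ , s⟹ , q) , h′ = app s₁ s′ , gmap (λ x → case x s₁ s₂) case-ξ s⟹ ◅◅ case-β₁ q ◅ ε ,
                                  𝓛-app n (𝓛-pred n h₁) h′
  simulate _ (case-β₂ p) with proj₂ (𝓛⇒𝓥 h) _ p
  ... | s′ , (_ , s⟹ , q) , h′ = app s₂ s′ , gmap (λ x → case x s₁ s₂) case-ξ s⟹ ◅◅ case-β₂ q ◅ ε ,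
                                  𝓛-app n (𝓛-pred n h₂) h′

𝓛-pair : ∀ n {τ₁ τ₂} {t s : Tm τ₁} {t₂ s₂ : Tm τ₂} →
         𝓛 n _ t s → 𝓛 n _ t₂ s₂ → 𝓛 n (τ₁ ⊠ τ₂) (pair t t₂) (pair s s₂)
𝓛-pair zero    _ _ = tt
𝓛-pair (suc n) {s = s} {s₂ = s₂} h h₂ = 𝓛-pair n (𝓛-pred n h) (𝓛-pred n h₂) , (λ _ ()) ,
  λ { _ _ pair₁ pair₂ → s , s₂ , (_ , ε , pair₁) , (_ , ε , pair₂) , 𝓛-pred n h , 𝓛-pred n h₂ }

𝓛-fst : ∀ n {τ₁ τ₂} {t s : Tm (τ₁ ⊠ τ₂)} → 𝓛 n _ t s → 𝓛 n τ₁ (fst t) (fst s)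
𝓛-fst zero    _ = tt
𝓛-fst (suc n) {τ₁} {t = t} {s} h = 𝓛-fst n (𝓛-pred n h) , simulate , 𝓥-vacuous _ _ τ₁ (λ ())
  where
  simulate : 𝓔 (𝓛 n) τ₁ (fst t) (fst s)
  simulate _ (fst-ξ p) with 𝓛⇒𝓔 h _ p
  ... | s′ , s⟹s′ , h′ = fst s′ , gmap fst fst-ξ s⟹s′ , 𝓛-fst n h′
  simulate _ (fst-β pair₁) with 𝓛⇒𝓥 h _ _ pair₁ pair₂
  ... | s₁ , _ , (_ , s⟹ , q) , _ , h′ , _ = s₁ , gmap fst fst-ξ s⟹ ◅◅ fst-β q ◅ ε , h′

𝓛-snd : ∀ n {τ₁ τ₂} {t s : Tm (τ₁ ⊠ τ₂)} → 𝓛 n _ t s → 𝓛 n τ₂ (snd t) (snd s)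
𝓛-snd zero    _ = tt
𝓛-snd (suc n) {τ₂ = τ₂} {t = t} {s} h = 𝓛-snd n (𝓛-pred n h) , simulate , 𝓥-vacuous _ _ τ₂ (λ ())
  where
  simulate : 𝓔 (𝓛 n) τ₂ (snd t) (snd s)
  simulate _ (snd-ξ p) with 𝓛⇒𝓔 h _ p
  ... | s′ , s⟹s′ , h′ = snd s′ , gmap snd snd-ξ s⟹s′ , 𝓛-snd n h′
  simulate _ (snd-β pair₂) with 𝓛⇒𝓥 h _ _ pair₁ pair₂
  ... | _ , s₂ , _ , (_ , s⟹ , q) , _ , h′ = s₂ , gmap snd snd-ξ s⟹ ◅◅ snd-β q ◅ ε , h′

𝓛-fold : ∀ n {τ} {t s : Tm (τ [ μ τ ]₀)} → 𝓛 n _ t s → 𝓛 n (μ τ) (fold τ t) (fold τ s)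
𝓛-fold zero    _ = tt
𝓛-fold (suc n) {s = s} h = 𝓛-fold n (𝓛-pred n h) , (λ _ ()) ,
  λ { _ fold-lab → s , (_ , ε , fold-lab) , 𝓛-pred n h }

𝓛-unfold : ∀ n {τ} {t s : Tm (μ τ)} → 𝓛 n _ t s → 𝓛 n (τ [ μ τ ]₀) (unfold τ t) (unfold τ s)
𝓛-unfold zero    _ = tt
𝓛-unfold (suc n) {τ} {t} {s} h = 𝓛-unfold n (𝓛-pred n h) , simulate , 𝓥-vacuous _ _ _ (λ ())
  where
  simulate : 𝓔 (𝓛 n) (τ [ μ τ ]₀) (unfold τ t) (unfold τ s)
  simulate _ (unfold-ξ p) with 𝓛⇒𝓔 h _ p
  ... | s′ , s⟹s′ , h′ = unfold τ s′ , gmap (unfold τ) unfold-ξ s⟹s′ , 𝓛-unfold n h′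
  simulate _ (unfold-β p) with 𝓛⇒𝓥 h _ p
  ... | s′ , (_ , s⟹ , q) , h′ = s′ , gmap (unfold τ) unfold-ξ s⟹ ◅◅ unfold-β q ◅ ε , h′

𝓛-plug : ∀ n {σ τ} {t s : Tm σ} → 𝓛 n σ t s → (C : Exp (just σ) τ) → 𝓛 n τ (C [ t ]) (C [ s ])
𝓛-plug n h ·            = h
𝓛-plug n h S            = 𝓛-S n
𝓛-plug n h K            = 𝓛-K n
𝓛-plug n h I            = 𝓛-I n
𝓛-plug n h (S′ C)       = 𝓛-S′ n (𝓛-plug n h C)
𝓛-plug n h (S″ C D)     = 𝓛-S″ n (𝓛-plug n h C) (𝓛-plug n h D)
𝓛-plug n h (K′ C)       = 𝓛-K′ n (𝓛-plug n h C)
𝓛-plug n h (app C D)    = 𝓛-app n (𝓛-plug n h C) (𝓛-plug n h D)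
𝓛-plug n h (inl C)      = 𝓛-inl n (𝓛-plug n h C)
𝓛-plug n h (inr C)      = 𝓛-inr n (𝓛-plug n h C)
𝓛-plug n h (case C D E) = 𝓛-case n (𝓛-plug n h C) (𝓛-plug n h D) (𝓛-plug n h E)
𝓛-plug n h (pair C D)   = 𝓛-pair n (𝓛-plug n h C) (𝓛-plug n h D)
𝓛-plug n h (fst C)      = 𝓛-fst n (𝓛-plug n h C)
𝓛-plug n h (snd C)      = 𝓛-snd n (𝓛-plug n h C)
𝓛-plug n h (fold τ C)   = 𝓛-fold n (𝓛-plug n h C)
𝓛-plug n h (unfold τ C) = 𝓛-unfold n (𝓛-plug n h C)

length : ∀ {τ} {t u : Tm τ} → t ⟹ u → ℕ
length ε        = 0
length (_ ◅ st) = suc (length st)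

𝓛-simulates-⟹ : ∀ {τ} {t t′ s : Tm τ} (st : t ⟹ t′) m → 𝓛 (length st + m) τ t s →
                 Σ (Tm τ) λ s′ → (s ⟹ s′) × 𝓛 m τ t′ s′
𝓛-simulates-⟹ ε        m h = _ , ε , h
𝓛-simulates-⟹ (p ◅ st) m h with 𝓛⇒𝓔 h _ p
... | s₁ , s⟹s₁ , h₁ with 𝓛-simulates-⟹ st m h₁
... | s′ , s₁⟹s′ , h′ = s′ , s⟹s₁ ◅◅ s₁⟹s′ , h′

-- Any argument e is related to itself by 𝓛⁰, which is total.
𝓛¹-labelled⇒⇓ : ∀ {τ σ} {t s : Tm τ} {l : Lab τ σ} {u : Tm σ} →
                𝓛 1 τ t s → t —[ l ]→ u → s ⇓
𝓛¹-labelled⇒⇓ {l = arg e} h p with 𝓛⇒𝓥 h e e tt _ p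
... | s′ , w , _ = _ , arg e , s′ , w
𝓛¹-labelled⇒⇓ {l = ⊞₁} h p with proj₁ (𝓛⇒𝓥 h) _ p
... | s′ , w , _ = _ , ⊞₁ , s′ , w
𝓛¹-labelled⇒⇓ {l = ⊞₂} h p with proj₂ (𝓛⇒𝓥 h) _ p
... | s′ , w , _ = _ , ⊞₂ , s′ , w
𝓛¹-labelled⇒⇓ {l = ⊠₁} h pair₁ with 𝓛⇒𝓥 h _ _ pair₁ pair₂
... | s₁ , _ , w , _ = _ , ⊠₁ , s₁ , w
𝓛¹-labelled⇒⇓ {l = ⊠₂} h pair₂ with 𝓛⇒𝓥 h _ _ pair₁ pair₂
... | _ , s₂ , _ , w , _ = _ , ⊠₂ , s₂ , w
𝓛¹-labelled⇒⇓ {l = μl} h p with 𝓛⇒𝓥 h _ p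
... | s′ , w , _ = _ , μl , s′ , w

⇓-⟹-backward : ∀ {τ} {s s′ : Tm τ} → s ⟹ s′ → s′ ⇓ → s ⇓
⇓-⟹-backward s⟹s′ (σ , l , u , r , s′⟹r , q) = σ , l , u , r , s⟹s′ ◅◅ s′⟹r , q

corollary3p6 : (τ : Type) (t s : Tm τ) → 𝓛ω τ t s → _≲_ {τ} t s
corollary3p6 τ t s h τ′ C _ (_ , _ , _ , t′ , C[t]⟹t′ , t′→u)
  with 𝓛-simulates-⟹ C[t]⟹t′ 1 (𝓛-plug _ (h _) C)
... | s′ , C[s]⟹s′ , h′ = ⇓-⟹-backward C[s]⟹s′ (𝓛¹-labelled⇒⇓ h′ t′→u)
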